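{- If $n > 3$ is an integer, then \[ \sum_{d=1}^{n} \mu(d)\, 2^{\lfloor n/d\rfloor - \lfloor (n-3)/d\rfloor} = \begin{cases} 3 + M(n), & \text{if } n \text{ is even},\\ 4 + M(n), & \text{if } n \text{ is odd}.\end{cases} \]
   Context: $\mu$ is the Möbius function, $\lfloor x\rfloor$ is the floor of $x$, and $M(n) = \sum_{d=1}^n \mu(d)$ is the Mertens function. -}

module Defs where

open import Data.Nat using (ℕ; zero; suc; _+_; _∸_; _^_; _/_; _%_; _≤ᵇ_)
open import Data.Bool using (Bool; true; false; if_then_else_)
open import Data.Integer as ℤ using (ℤ; +_; -_; 0ℤ; 1ℤ)

-- Computed by trial division: find the least divisor p ≥ 2 of m
-- (necessarily prime), remove it once; if p still divides the
-- quotient, μ = 0, otherwise μ(m) = - μ(m / p).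
-- `fuel` bounds the recursion; μ supplies enough fuel (n).

isDiv : ℕ → ℕ → Bool
isDiv zero m = false
isDiv (suc k) m = (m % suc k) ≤ᵇ 0

leastDivFrom : ℕ → ℕ → ℕ → ℕ
leastDivFrom zero p m = m
leastDivFrom (suc b) p m = if isDiv p m then p else leastDivFrom b (suc p) m

lpf : ℕ → ℕ
lpf m = leastDivFrom m 2 m

divBy : ℕ → ℕ → ℕ
divBy m zero = 0
divBy m (suc k) = m / suc k

μ-fuel : ℕ → ℕ → ℤ
μ-fuel zero m = 0ℤ
μ-fuel (suc f) zero = 0ℤ
μ-fuel (suc f) (suc zero) = 1ℤ
μ-fuel (suc f) m@(suc (suc _)) =
  let p = lpf m
      q = divBy m p
  in if isDiv p q then 0ℤ else - μ-fuel f q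

μ : ℕ → ℤ
μ n = μ-fuel n n

sum1to : ℕ → (ℕ → ℤ) → ℤ
sum1to zero f = 0ℤ
sum1to (suc n) f = sum1to n f ℤ.+ f (suc n)

M : ℕ → ℤ
M n = sum1to n μ

-- ⌊n/d⌋ for d ≥ 1 (value at d = 0 irrelevant; set to 0)
fl : ℕ → ℕ → ℕ
fl n zero = 0
fl n (suc k) = n / suc k

even? : ℕ → Bool
even? n = (n % 2) ≤ᵇ 0

{-# OPTIONS --safe #-}
-- For d ≥ 1, ⌊n/d⌋ − ⌊(n−3)/d⌋ counts the multiples of d among n−2, n−1, n, so
-- 2^(⌊n/d⌋ − ⌊(n−3)/d⌋) = (1 + [d ∣ n−2]) (1 + [d ∣ n−1]) (1 + [d ∣ n]) = 1 + Σ_S [d ∣ gcd S],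
-- S ranging over the nonempty subsets of {n−2, n−1, n}. Since Σ_{d ≤ N} μ(d) [d ∣ m] = [m = 1]
-- for 1 ≤ m ≤ N, the sum is M(n) plus the number of such S with gcd S = 1: the three containing
-- two consecutive numbers, and {n−2, n} exactly when n is odd. The divisor-sum identity follows
-- by splitting off the multiples of a prime p ∣ m, using μ(p e) = −μ(e) for p ∤ e and 0 for p ∣ e,
-- which in turn comes from the least-prime-factor recursion defining μ by induction on e.
module Submission where

open import Defs
open import Data.Nat using (ℕ; zero; suc; _<_; _∸_; _^_; _≤_; _/_; _%_; NonZero; z≤n; s≤s;
  >-nonZero⁻¹; n>1⇒nonTrivial; nonTrivial⇒n>1) renaming (_+_ to _+ℕ_; _*_ to _*ℕ_)
import Data.Nat.Properties as ℕ
open import Data.Nat.Divisibility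
open import Data.Nat.DivMod using (m≡m%n+[m/n]*n; m%n<n; m/n*n≤m; m*[n/m]≡n; m*n/n≡m; m/n<m;
  m<n*o⇒m/o<n; /-monoˡ-≤; /-congˡ; 0/n≡0)
open import Data.Nat.Primality using (Prime; prime[2]; prime⇒nonTrivial; prime⇒nonZero;
  prime⇒irreducible; euclidsLemma; _Rough_; 2-rough; ∤⇒rough-suc; rough∧∣⇒prime)
open import Data.Nat.Coprimality as CP using (Coprime; coprime-divisor)
open import Data.Nat.GCD using (gcd; gcd[m,n]∣m; gcd[m,n]∣n; gcd-greatest; gcd[m,n]≢0;
  gcd[m,n]≤n; gcd-zeroˡ; gcd-zeroʳ; gcd-GCD; module GCD)
open import Data.Nat.Induction using (<-rec)
open import Data.Integer using (ℤ; +_; _+_; _*_; -_; 0ℤ; 1ℤ)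
import Data.Integer.Properties as ℤ
open import Data.Integer.Tactic.RingSolver using (solve-∀)
import Algebra.Properties.CommutativeSemigroup as CSemigroup
open CSemigroup ℤ.+-commutativeSemigroup using (xy∙z≈xz∙y; interchange)
open import Data.Bool using (true; false; if_then_else_)
open import Data.Product using (_×_; _,_; proj₂)
open import Data.Sum using (inj₁; inj₂)
open import Data.Empty using (⊥-elim)
open import Data.List using (List; []; _∷_; foldr; map)
open import Data.List.Relation.Unary.All using (All; []; _∷_)
open import Function.Bundles using (_⇔_; mk⇔)
open import Relation.Nullary using (Dec; yes; no; does)
open import Relation.Nullary.Decidable using (dec-true; dec-false; does-⇔)
open import Relation.Binary.PropositionalEquality
  using (_≡_; _≢_; refl; sym; trans; cong; cong₂; subst; module ≡-Reasoning)

if-∣ : ∀ {A : Set} {d m} (x y : A) → d ∣ m → (if does (d ∣? m) then x else y) ≡ x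
if-∣ {d = d} {m} x y d∣m = cong (if_then x else y) (dec-true (d ∣? m) d∣m)

if-∤ : ∀ {A : Set} {d m} (x y : A) → d ∤ m → (if does (d ∣? m) then x else y) ≡ y
if-∤ {d = d} {m} x y d∤m = cong (if_then x else y) (dec-false (d ∣? m) d∤m)

if-same : ∀ {A : Set} b (x : A) → (if b then x else x) ≡ x
if-same true  x = refl
if-same false x = refl

if-swap : ∀ b c (x : ℤ) →
  (if b then 0ℤ else - (if c then 0ℤ else - x)) ≡ (if c then 0ℤ else - (if b then 0ℤ else - x))
if-swap true  true  x = refl
if-swap true  false x = refl
if-swap false true  x = refl
if-swap false false x = refl

if0-*-neg : ∀ b (x y : ℤ) → (if b then 0ℤ else - x) * y ≡ - (if b then 0ℤ else x * y)
if0-*-neg true  x y = refl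
if0-*-neg false x y = sym (ℤ.neg-distribˡ-* x y)

-- Divisibility indicators and floor division

[_∣_] : ℕ → ℕ → ℕ
[ d ∣ m ] = if does (d ∣? m) then 1 else 0

[∣]-cong : ∀ {d a d′ b} → d ∣ a ⇔ d′ ∣ b → [ d ∣ a ] ≡ [ d′ ∣ b ]
[∣]-cong {d} {a} {d′} {b} d∣a⇔d′∣b = cong (if_then 1 else 0) (does-⇔ d∣a⇔d′∣b (d ∣? a) (d′ ∣? b))

>⇒[∣]≡0 : ∀ {d q} .{{_ : NonZero q}} → q < d → [ d ∣ q ] ≡ 0
>⇒[∣]≡0 q<d = if-∤ 1 0 (>⇒∤ q<d)

[∣]-*-gcd : ∀ d a b → + [ d ∣ a ] * + [ d ∣ b ] ≡ + [ d ∣ gcd a b ]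
[∣]-*-gcd d a b with d ∣? a | d ∣? b
... | yes d∣a | yes d∣b = sym (cong +_ (if-∣ 1 0 (gcd-greatest d∣a d∣b)))
... | yes _   | no d∤b  = sym (cong +_ (if-∤ 1 0 (λ d∣g → d∤b (∣-trans d∣g (gcd[m,n]∣n a b)))))
... | no d∤a  | _       = sym (cong +_ (if-∤ 1 0 (λ d∣g → d∤a (∣-trans d∣g (gcd[m,n]∣m a b)))))

2^[∣] : ∀ d m → + (2 ^ [ d ∣ m ]) ≡ 1ℤ + + [ d ∣ m ]
2^[∣] d m with does (d ∣? m)
... | true = refl
... | false = refl

/-unique : ∀ {N d q} .{{_ : NonZero d}} → q *ℕ d ≤ N → N < suc q *ℕ d → N / d ≡ q
/-unique {N} {d} {q} lo hi = ℕ.≤-antisym (ℕ.m<1+n⇒m≤n (m<n*o⇒m/o<n hi))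
  (subst (_≤ N / d) (m*n/n≡m q d) (/-monoˡ-≤ d lo))

m<[1+m/n]*n : ∀ N d .{{_ : NonZero d}} → N < suc (N / d) *ℕ d
m<[1+m/n]*n N d = subst (_< suc (N / d) *ℕ d) (sym (m≡m%n+[m/n]*n N d))
  (ℕ.+-monoˡ-< ((N / d) *ℕ d) (m%n<n N d))

/-suc-∤ : ∀ {N d} .{{_ : NonZero d}} → d ∤ suc N → suc N / d ≡ N / d
/-suc-∤ {N} {d} d∤ = /-unique (ℕ.≤-trans (m/n*n≤m N d) (ℕ.n≤1+n N))
  (ℕ.≤∧≢⇒< (m<[1+m/n]*n N d) (λ eq → d∤ (divides (suc (N / d)) eq)))

/-suc-∣ : ∀ {N d} .{{_ : NonZero d}} → d ∣ suc N → suc N / d ≡ suc (N / d)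
/-suc-∣ {N} {d} (divides (suc c) eq) = begin
    suc N / d        ≡⟨ /-congˡ eq ⟩
    suc c *ℕ d / d   ≡⟨ m*n/n≡m (suc c) d ⟩
    suc c            ≡⟨ cong suc (/-unique c*d≤N (ℕ.≤-reflexive eq)) ⟨
    suc (N / d)      ∎
  where
  open ≡-Reasoning
  c*d≤N : c *ℕ d ≤ N
  c*d≤N = ℕ.m<1+n⇒m≤n (subst (c *ℕ d <_) (sym eq) (ℕ.m<n+m (c *ℕ d) (>-nonZero⁻¹ d)))

/-suc : ∀ N d .{{_ : NonZero d}} → suc N / d ≡ N / d +ℕ [ d ∣ suc N ]
/-suc N d with d ∣? suc N
... | yes d∣ = trans (/-suc-∣ d∣) (ℕ.+-comm 1 (N / d))
... | no d∤ = trans (/-suc-∤ d∤) (sym (ℕ.+-identityʳ (N / d)))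

[3+k]/d∸k/d : ∀ k d .{{_ : NonZero d}} →
  (3 +ℕ k) / d ∸ k / d ≡ [ d ∣ 1 +ℕ k ] +ℕ [ d ∣ 2 +ℕ k ] +ℕ [ d ∣ 3 +ℕ k ]
[3+k]/d∸k/d k d = trans (cong (_∸ k / d) three-steps) (ℕ.m+n∸m≡n (k / d) (i₁ +ℕ i₂ +ℕ i₃))
  where
  open ≡-Reasoning
  i₁ i₂ i₃ : ℕ
  i₁ = [ d ∣ 1 +ℕ k ]
  i₂ = [ d ∣ 2 +ℕ k ]
  i₃ = [ d ∣ 3 +ℕ k ]
  three-steps : (3 +ℕ k) / d ≡ k / d +ℕ (i₁ +ℕ i₂ +ℕ i₃)
  three-steps = begin
    (3 +ℕ k) / d                ≡⟨ /-suc (2 +ℕ k) d ⟩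
    (2 +ℕ k) / d +ℕ i₃          ≡⟨ cong (_+ℕ i₃) (/-suc (1 +ℕ k) d) ⟩
    (1 +ℕ k) / d +ℕ i₂ +ℕ i₃    ≡⟨ cong (λ x → x +ℕ i₂ +ℕ i₃) (/-suc k d) ⟩
    k / d +ℕ i₁ +ℕ i₂ +ℕ i₃     ≡⟨ cong (_+ℕ i₃) (ℕ.+-assoc (k / d) i₁ i₂) ⟩
    k / d +ℕ (i₁ +ℕ i₂) +ℕ i₃   ≡⟨ ℕ.+-assoc (k / d) (i₁ +ℕ i₂) i₃ ⟩
    k / d +ℕ (i₁ +ℕ i₂ +ℕ i₃)   ∎

-- Sums over 1, …, N

sum1to-cong : ∀ N {f g : ℕ → ℤ} → (∀ d → f (suc d) ≡ g (suc d)) → sum1to N f ≡ sum1to N g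
sum1to-cong zero    f≗g = refl
sum1to-cong (suc N) f≗g = cong₂ _+_ (sum1to-cong N f≗g) (f≗g N)

sum1to-+ : ∀ N (f g : ℕ → ℤ) → sum1to N (λ d → f d + g d) ≡ sum1to N f + sum1to N g
sum1to-+ zero    f g = refl
sum1to-+ (suc N) f g = trans (cong (_+ (f (suc N) + g (suc N))) (sum1to-+ N f g))
  (interchange (sum1to N f) (sum1to N g) (f (suc N)) (g (suc N)))

sum1to-neg : ∀ N (f : ℕ → ℤ) → sum1to N (λ d → - f d) ≡ - sum1to N f
sum1to-neg zero    f = refl
sum1to-neg (suc N) f = trans (cong (_+ - f (suc N)) (sum1to-neg N f))
  (sym (ℤ.neg-distrib-+ (sum1to N f) (f (suc N))))

sum1to-truncate : ∀ {K} N (f : ℕ → ℤ) → (∀ {d} → K < d → f d ≡ 0ℤ) → K ≤ N →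
  sum1to N f ≡ sum1to K f
sum1to-truncate N f f≡0 K≤N with ℕ.m≤n⇒m<n∨m≡n K≤N
... | inj₂ refl = refl
sum1to-truncate {K} (suc N) f f≡0 K≤N | inj₁ K<1+N = begin
  sum1to N f + f (suc N)   ≡⟨ cong₂ _+_ (sum1to-truncate N f f≡0 (ℕ.m<1+n⇒m≤n K<1+N)) (f≡0 K<1+N) ⟩
  sum1to K f + 0ℤ          ≡⟨ ℤ.+-identityʳ (sum1to K f) ⟩
  sum1to K f               ∎
  where open ≡-Reasoning

sum1to-multiples : ∀ N p .{{_ : NonZero p}} (f : ℕ → ℤ) →
  sum1to N f ≡ sum1to N (λ d → if does (p ∣? d) then 0ℤ else f d) + sum1to (N / p) (λ e → f (p *ℕ e))
sum1to-multiples zero    p f = cong (λ x → 0ℤ + sum1to x (λ e → f (p *ℕ e))) (sym (0/n≡0 p))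
sum1to-multiples (suc N) p f with p ∣? suc N
... | yes p∣ = begin
  sum1to N f + f (suc N)
    ≡⟨ cong₂ _+_ (sum1to-multiples N p f) (cong f (sym p*[1+N/p]≡1+N)) ⟩
  sum1to N f′ + sum1to (N / p) f″ + f″ (suc (N / p))
    ≡⟨ ℤ.+-assoc (sum1to N f′) _ _ ⟩
  sum1to N f′ + sum1to (suc (N / p)) f″
    ≡⟨ cong₂ _+_ (ℤ.+-identityʳ (sum1to N f′)) (cong (λ x → sum1to x f″) (/-suc-∣ p∣)) ⟨
  sum1to N f′ + 0ℤ + sum1to (suc N / p) f″
    ∎
  where
  open ≡-Reasoning
  f′ = λ d → if does (p ∣? d) then 0ℤ else f d
  f″ = λ e → f (p *ℕ e)
  p*[1+N/p]≡1+N : p *ℕ suc (N / p) ≡ suc N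
  p*[1+N/p]≡1+N = trans (cong (p *ℕ_) (sym (/-suc-∣ p∣))) (m*[n/m]≡n p∣)
... | no p∤ = begin
  sum1to N f + f (suc N)
    ≡⟨ cong (_+ f (suc N)) (sum1to-multiples N p f) ⟩
  sum1to N f′ + sum1to (N / p) f″ + f (suc N)
    ≡⟨ xy∙z≈xz∙y (sum1to N f′) _ _ ⟩
  sum1to N f′ + f (suc N) + sum1to (N / p) f″
    ≡⟨ cong (λ x → sum1to N f′ + f (suc N) + sum1to x f″) (/-suc-∤ p∤) ⟨
  sum1to N f′ + f (suc N) + sum1to (suc N / p) f″
    ∎
  where
  open ≡-Reasoning
  f′ = λ d → if does (p ∣? d) then 0ℤ else f d
  f″ = λ e → f (p *ℕ e)

-- Primes and the least prime factor

prime⇒2≤ : ∀ {p} → Prime p → 2 ≤ p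
prime⇒2≤ {p} pp = nonTrivial⇒n>1 p {{ prime⇒nonTrivial pp }}

euclidsLemma-∤ : ∀ {p} m n → Prime p → p ∤ m → p ∣ m *ℕ n → p ∣ n
euclidsLemma-∤ m n pp p∤m p∣mn with euclidsLemma m n pp p∣mn
... | inj₁ p∣m = ⊥-elim (p∤m p∣m)
... | inj₂ p∣n = p∣n

prime∤⇒coprime : ∀ {p n} → Prime p → p ∤ n → Coprime p n
prime∤⇒coprime pp p∤n (i∣p , i∣n) with prime⇒irreducible pp i∣p
... | inj₁ i≡1 = i≡1
... | inj₂ refl = ⊥-elim (p∤n i∣n)

prime∤prime : ∀ {p P} → Prime p → Prime P → P ≢ p → P ∤ p
prime∤prime pp PP P≢p P∣p with prime⇒irreducible pp P∣p
... | inj₁ refl = ℕ.<-irrefl refl (prime⇒2≤ PP)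
... | inj₂ P≡p  = P≢p P≡p

isDiv≡does∣? : ∀ k m → isDiv (suc k) m ≡ does (suc k ∣? m)
isDiv≡does∣? k m with m % suc k
... | zero  = refl
... | suc _ = refl

record IsLeastDivisor (r m : ℕ) : Set where
  field
    nontrivial : 2 ≤ r
    divides-m  : r ∣ m
    rough      : r Rough m

leastDivFrom-least : ∀ b p {m} → 2 ≤ p → 2 ≤ m → m < p +ℕ b → p Rough m →
  IsLeastDivisor (leastDivFrom b p m) m
leastDivFrom-least zero p {m} 2≤p 2≤m m<p+0 p-rough = record
  { nontrivial = 2≤m
  ; divides-m  = ∣-refl
  ; rough      = λ d∣m → p-rough (hasNonTrivialDivisor-≤ d∣m m≤p)
  }
  where m≤p = ℕ.<⇒≤ (subst (m <_) (ℕ.+-identityʳ p) m<p+0)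
leastDivFrom-least (suc b) p@(suc k) {m} 2≤p 2≤m m<p+1+b p-rough =
  subst (λ r → IsLeastDivisor r m)
    (cong (if_then p else leastDivFrom b (suc p) m) (sym (isDiv≡does∣? k m))) (by-cases (p ∣? m))
  where
  by-cases : (p∣?m : Dec (p ∣ m)) → IsLeastDivisor (if does p∣?m then p else leastDivFrom b (suc p) m) m
  by-cases (yes p∣m) = record { nontrivial = 2≤p ; divides-m = p∣m ; rough = p-rough }
  by-cases (no p∤m)  = leastDivFrom-least b (suc p) (ℕ.m≤n⇒m≤1+n 2≤p) 2≤m
    (subst (m <_) (ℕ.+-suc p b) m<p+1+b) (∤⇒rough-suc p∤m p-rough)

lpf-least : ∀ {m} → 2 ≤ m → IsLeastDivisor (lpf m) m
lpf-least {m} 2≤m = leastDivFrom-least m 2 ℕ.≤-refl 2≤m (ℕ.m<n+m m (s≤s z≤n)) 2-rough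

lpf∣ : ∀ {m} → 2 ≤ m → lpf m ∣ m
lpf∣ 2≤m = IsLeastDivisor.divides-m (lpf-least 2≤m)

2≤lpf : ∀ {m} → 2 ≤ m → 2 ≤ lpf m
2≤lpf 2≤m = IsLeastDivisor.nontrivial (lpf-least 2≤m)

lpf-prime : ∀ {m} → 2 ≤ m → Prime (lpf m)
lpf-prime {m} 2≤m = rough∧∣⇒prime {{ n>1⇒nonTrivial nontrivial }} rough divides-m
  where open IsLeastDivisor (lpf-least 2≤m)

lpf≤ : ∀ {m d} → 2 ≤ m → 2 ≤ d → d ∣ m → lpf m ≤ d
lpf≤ {m} {d} 2≤m 2≤d d∣m =
  ℕ.≮⇒≥ λ d<lpf → rough (hasNonTrivialDivisor {{ n>1⇒nonTrivial 2≤d }} d<lpf d∣m)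
  where open IsLeastDivisor (lpf-least 2≤m)

lpf-∣-factor : ∀ n .{{ _ : NonZero n }} {e} → 2 ≤ e → lpf (n *ℕ e) ∣ e → lpf e ≡ lpf (n *ℕ e)
lpf-∣-factor n {e@(suc _)} 2≤e lpf∣e = ℕ.≤-antisym
  (lpf≤ 2≤e (2≤lpf 2≤ne) lpf∣e)
  (lpf≤ 2≤ne (2≤lpf 2≤e) (∣-trans (lpf∣ 2≤e) (n∣m*n n)))
  where 2≤ne = ℕ.≤-trans 2≤e (ℕ.m≤n*m e n)

lpf[p*e]∣e : ∀ {p e} → Prime p → 2 ≤ p *ℕ e → lpf (p *ℕ e) ≢ p → lpf (p *ℕ e) ∣ e
lpf[p*e]∣e {p} {e} pp 2≤pe P≢p = euclidsLemma-∤ p e (lpf-prime 2≤pe)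
  (prime∤prime pp (lpf-prime 2≤pe) P≢p) (lpf∣ 2≤pe)

divBy-lpf< : ∀ {m} → 2 ≤ m → divBy m (lpf m) < m
divBy-lpf< {m@(suc _)} 2≤m with lpf m | 2≤lpf 2≤m
... | suc zero    | s≤s ()
... | suc (suc j) | _ = m/n<m m (2 +ℕ j) (s≤s (s≤s z≤n))

-- The Möbius function

μ-fuel-stable : ∀ {f g} m → m ≤ f → m ≤ g → μ-fuel f m ≡ μ-fuel g m
μ-fuel-stable {zero}  {zero}  zero _ _ = refl
μ-fuel-stable {zero}  {suc g} zero _ _ = refl
μ-fuel-stable {suc f} {zero}  zero _ _ = refl
μ-fuel-stable {suc f} {suc g} zero _ _ = refl
μ-fuel-stable {suc f} {suc g} 1    _ _ = refl
μ-fuel-stable {suc f} {suc g} m@(suc (suc _)) m≤f m≤g =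
  cong (if isDiv (lpf m) q then 0ℤ else_) (cong -_ (μ-fuel-stable q (smaller m≤f) (smaller m≤g)))
  where
  q = divBy m (lpf m)
  smaller : ∀ {h} → m ≤ suc h → q ≤ h
  smaller m≤1+h = ℕ.m<1+n⇒m≤n (ℕ.<-≤-trans (divBy-lpf< (s≤s (s≤s z≤n))) m≤1+h)

μ-unfold : ∀ {m} → 2 ≤ m →
  μ m ≡ (if isDiv (lpf m) (divBy m (lpf m)) then 0ℤ else - μ (divBy m (lpf m)))
μ-unfold {suc zero} (s≤s ())
μ-unfold {m@(suc (suc _))} 2≤m =
  cong (if isDiv (lpf m) q then 0ℤ else_) (cong -_ (μ-fuel-stable q q<m ℕ.≤-refl))
  where
  q = divBy m (lpf m)
  q<m = ℕ.m<1+n⇒m≤n (divBy-lpf< 2≤m)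

μ-lpf : ∀ {p q} → 2 ≤ p → lpf (p *ℕ q) ≡ p → μ (p *ℕ q) ≡ (if does (p ∣? q) then 0ℤ else - μ q)
μ-lpf {p} {zero} _ _ = trans (cong μ (ℕ.*-zeroʳ p)) (sym (if-∣ 0ℤ (- μ 0) (p ∣0)))
μ-lpf {suc zero} {suc _} (s≤s ()) _
μ-lpf {p@(suc (suc k))} {q@(suc _)} 2≤p lpf≡p = begin
  μ (p *ℕ q)
    ≡⟨ μ-unfold 2≤pq ⟩
  unfolded (lpf (p *ℕ q)) (divBy (p *ℕ q) (lpf (p *ℕ q)))
    ≡⟨ cong (λ r → unfolded r (divBy (p *ℕ q) r)) lpf≡p ⟩
  unfolded p (p *ℕ q / p)
    ≡⟨ cong (unfolded p) pq/p≡q ⟩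
  unfolded p q
    ≡⟨ cong (if_then 0ℤ else - μ q) (isDiv≡does∣? (suc k) q) ⟩
  (if does (p ∣? q) then 0ℤ else - μ q)
    ∎
  where
  open ≡-Reasoning
  unfolded : ℕ → ℕ → ℤ
  unfolded r x = if isDiv r x then 0ℤ else - μ x
  2≤pq = ℕ.≤-trans 2≤p (ℕ.m≤m*n p q)
  pq/p≡q = trans (/-congˡ {o = p} (ℕ.*-comm p q)) (m*n/n≡m q p)

-- Induction on e: when the least prime factor P of p e is not p, it is the least prime
-- factor of e as well, and both μ (p e) and μ e unfold along P.
μ-p* : ∀ {p} → Prime p → ∀ e → μ (p *ℕ e) ≡ (if does (p ∣? e) then 0ℤ else - μ e)
μ-p* {p} pp = <-rec _ step
  where
  step : ∀ e → (∀ {e′} → e′ < e → μ (p *ℕ e′) ≡ (if does (p ∣? e′) then 0ℤ else - μ e′)) →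
    μ (p *ℕ e) ≡ (if does (p ∣? e) then 0ℤ else - μ e)
  step zero _ = trans (cong μ (ℕ.*-zeroʳ p)) (sym (if-∣ 0ℤ (- μ 0) (p ∣0)))
  step e@(suc _) ih with lpf (p *ℕ e) ℕ.≟ p
  ... | yes lpf≡p = μ-lpf (prime⇒2≤ pp) lpf≡p
  ... | no P≢p = begin
    μ (p *ℕ e)
      ≡⟨ cong μ pe≡P[pe′] ⟩
    μ (P *ℕ (p *ℕ e′))
      ≡⟨ μ-lpf 2≤P (cong lpf (sym pe≡P[pe′])) ⟩
    (if does (P ∣? p *ℕ e′) then 0ℤ else - μ (p *ℕ e′))
      ≡⟨ cong₂ (if_then 0ℤ else_) (does-⇔ P∣pe′⇔P∣e′ (P ∣? p *ℕ e′) (P ∣? e′)) (cong -_ (ih e′<e)) ⟩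
    (if does (P ∣? e′) then 0ℤ else - (if does (p ∣? e′) then 0ℤ else - μ e′))
      ≡⟨ if-swap (does (P ∣? e′)) (does (p ∣? e′)) (μ e′) ⟩
    (if does (p ∣? e′) then 0ℤ else - (if does (P ∣? e′) then 0ℤ else - μ e′))
      ≡⟨ cong₂ (if_then 0ℤ else_) (does-⇔ p∣e⇔p∣e′ (p ∣? e) (p ∣? e′)) (cong -_ μe) ⟨
    (if does (p ∣? e) then 0ℤ else - μ e)
      ∎
    where
    open ≡-Reasoning
    P = lpf (p *ℕ e)
    2≤pe = ℕ.≤-trans (prime⇒2≤ pp) (ℕ.m≤m*n p e)
    PP = lpf-prime 2≤pe
    2≤P = prime⇒2≤ PP
    P∣e = lpf[p*e]∣e pp 2≤pe P≢p
    e′ = quotient P∣e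
    e′<e = quotient-< P∣e {{ prime⇒nonTrivial PP }}
    e≡Pe′ : e ≡ P *ℕ e′
    e≡Pe′ = m∣n⇒n≡m*quotient P∣e
    pe≡P[pe′] : p *ℕ e ≡ P *ℕ (p *ℕ e′)
    pe≡P[pe′] = trans (cong (p *ℕ_) e≡Pe′) (CSemigroup.x∙yz≈y∙xz ℕ.*-commutativeSemigroup p P e′)
    μe : μ e ≡ (if does (P ∣? e′) then 0ℤ else - μ e′)
    μe = trans (cong μ e≡Pe′) (μ-lpf 2≤P (trans (cong lpf (sym e≡Pe′))
           (lpf-∣-factor p {{ prime⇒nonZero pp }} (ℕ.≤-trans 2≤P (∣⇒≤ P∣e)) P∣e)))
    P∣pe′⇔P∣e′ : P ∣ p *ℕ e′ ⇔ P ∣ e′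
    P∣pe′⇔P∣e′ = mk⇔ (euclidsLemma-∤ p e′ PP (prime∤prime pp PP P≢p)) (∣n⇒∣m*n p)
    p∤P = prime∤prime PP pp (λ p≡P → P≢p (sym p≡P))
    p∣e⇔p∣e′ : p ∣ e ⇔ p ∣ e′
    p∣e⇔p∣e′ = mk⇔
      (λ p∣e → euclidsLemma-∤ P e′ pp p∤P (subst (p ∣_) e≡Pe′ p∣e))
      (λ p∣e′ → subst (p ∣_) (sym e≡Pe′) (∣n⇒∣m*n P p∣e′))

μ-coprime-part : ℕ → ℕ → ℕ → ℤ
μ-coprime-part p q d = if does (p ∣? d) then 0ℤ else μ d * + [ d ∣ q ]

μ-coprime-part-vanishes : ∀ p {q d} .{{_ : NonZero q}} → q < d → μ-coprime-part p q d ≡ 0ℤ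
μ-coprime-part-vanishes p {q} {d} q<d = begin
  (if does (p ∣? d) then 0ℤ else μ d * + [ d ∣ q ])
    ≡⟨ cong (λ x → if does (p ∣? d) then 0ℤ else μ d * + x) (>⇒[∣]≡0 q<d) ⟩
  (if does (p ∣? d) then 0ℤ else μ d * 0ℤ)
    ≡⟨ cong (if does (p ∣? d) then 0ℤ else_) (ℤ.*-zeroʳ (μ d)) ⟩
  (if does (p ∣? d) then 0ℤ else 0ℤ)
    ≡⟨ if-same (does (p ∣? d)) 0ℤ ⟩
  0ℤ
    ∎
  where open ≡-Reasoning

-- The divisors of p q prime to p are those of q, and p e divides p q iff e divides q; as
-- μ (p e) = - μ e for p ∤ e and 0 otherwise, the multiples of p contribute the negated sum.
sum-μ[∣p*q] : ∀ {p} .{{_ : NonZero p}} → Prime p → ∀ N q →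
  sum1to N (λ d → μ d * + [ d ∣ p *ℕ q ])
    ≡ sum1to N (μ-coprime-part p q) + - sum1to (N / p) (μ-coprime-part p q)
sum-μ[∣p*q] {p} pp N q = begin
  sum1to N f
    ≡⟨ sum1to-multiples N p f ⟩
  sum1to N f′ + sum1to (N / p) (λ e → f (p *ℕ e))
    ≡⟨ cong₂ _+_ (sum1to-cong N coprime) (sum1to-cong (N / p) multiple) ⟩
  sum1to N g + sum1to (N / p) (λ e → - g e)
    ≡⟨ cong (λ x → sum1to N g + x) (sum1to-neg (N / p) g) ⟩
  sum1to N g + - sum1to (N / p) g
    ∎
  where
  open ≡-Reasoning
  f f′ g : ℕ → ℤ
  f d = μ d * + [ d ∣ p *ℕ q ]
  f′ d = if does (p ∣? d) then 0ℤ else f d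
  g = μ-coprime-part p q
  coprime : ∀ d → f′ (suc d) ≡ g (suc d)
  coprime d with p ∣? suc d
  ... | yes _   = refl
  ... | no p∤d = cong (λ x → μ (suc d) * + x) ([∣]-cong (mk⇔
    (coprime-divisor (CP.sym (prime∤⇒coprime pp p∤d)))
    (λ d∣q → ∣-trans d∣q (n∣m*n p))))
  multiple : ∀ e → f (p *ℕ suc e) ≡ - g (suc e)
  multiple e = trans
    (cong₂ _*_ (μ-p* pp (suc e)) (cong +_ ([∣]-cong (mk⇔ (*-cancelˡ-∣ p) (*-monoʳ-∣ p)))))
    (if0-*-neg (does (p ∣? suc e)) (μ (suc e)) (+ [ suc e ∣ q ]))

möbius-sum : ∀ {N m} → 1 ≤ m → m ≤ N → sum1to N (λ d → μ d * + [ d ∣ m ]) ≡ + [ m ∣ 1 ]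
möbius-sum {N} {1} _ 1≤N = sum1to-truncate N _ vanish 1≤N
  where
  vanish : ∀ {d} → 1 < d → μ d * + [ d ∣ 1 ] ≡ 0ℤ
  vanish {d} 1<d = trans (cong (λ x → μ d * + x) (>⇒[∣]≡0 1<d)) (ℤ.*-zeroʳ (μ d))
möbius-sum {N} {m@(suc (suc _))} _ m≤N = begin
  sum1to N (λ d → μ d * + [ d ∣ m ])
    ≡⟨ cong (λ x → sum1to N (λ d → μ d * + [ d ∣ x ])) m≡pq ⟩
  sum1to N (λ d → μ d * + [ d ∣ p *ℕ q ])
    ≡⟨ sum-μ[∣p*q] pp N q ⟩
  sum1to N g + - sum1to (N / p) g
    ≡⟨ cong₂ (λ x y → x + - y) (truncate q≤N) (truncate q≤N/p) ⟩
  sum1to q g + - sum1to q g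
    ≡⟨ ℤ.+-inverseʳ (sum1to q g) ⟩
  0ℤ
    ∎
  where
  open ≡-Reasoning
  p = lpf m
  pp = lpf-prime {m} (s≤s (s≤s z≤n))
  p∣m = lpf∣ {m} (s≤s (s≤s z≤n))
  q = quotient p∣m
  instance
    p≢0 : NonZero p
    p≢0 = prime⇒nonZero pp
    q≢0 : NonZero q
    q≢0 = quotient≢0 p∣m
  m≡pq : m ≡ p *ℕ q
  m≡pq = m∣n⇒n≡m*quotient p∣m
  g = μ-coprime-part p q
  truncate : ∀ {M} → q ≤ M → sum1to M g ≡ sum1to q g
  truncate {M} q≤M = sum1to-truncate M g (μ-coprime-part-vanishes p) q≤M
  q≤N = ℕ.≤-trans (subst (q ≤_) (sym m≡pq) (ℕ.m≤n*m q p)) m≤N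
  q≤N/p = subst (_≤ N / p) (n/m≡quotient p∣m) (/-monoˡ-≤ p m≤N)

sumℤ : List ℤ → ℤ
sumℤ = foldr _+_ 0ℤ

möbius-sums : ∀ {N} ms → All (λ m → 1 ≤ m × m ≤ N) ms →
  sum1to N (λ d → μ d * sumℤ (map (λ m → + [ d ∣ m ]) ms)) ≡ sumℤ (map (λ m → + [ m ∣ 1 ]) ms)
möbius-sums {N} [] [] = sum1to-truncate N _ (λ {d} _ → ℤ.*-zeroʳ (μ d)) z≤n
möbius-sums {N} (m ∷ ms) ((1≤m , m≤N) ∷ bounds) = begin
  sum1to N (λ d → μ d * (+ [ d ∣ m ] + Σ d))
    ≡⟨ sum1to-cong N (λ d → ℤ.*-distribˡ-+ (μ (suc d)) _ (Σ (suc d))) ⟩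
  sum1to N (λ d → μ d * + [ d ∣ m ] + μ d * Σ d)
    ≡⟨ sum1to-+ N (λ d → μ d * + [ d ∣ m ]) (λ d → μ d * Σ d) ⟩
  sum1to N (λ d → μ d * + [ d ∣ m ]) + sum1to N (λ d → μ d * Σ d)
    ≡⟨ cong₂ _+_ (möbius-sum 1≤m m≤N) (möbius-sums ms bounds) ⟩
  + [ m ∣ 1 ] + sumℤ (map (λ m → + [ m ∣ 1 ]) ms)
    ∎
  where
  open ≡-Reasoning
  Σ : ℕ → ℤ
  Σ d = sumℤ (map (λ m → + [ d ∣ m ]) ms)

-- Sums of μ against products of divisibility indicators

gcd-bounds : ∀ x {y N} → 1 ≤ y → y ≤ N → 1 ≤ gcd x y × gcd x y ≤ N
gcd-bounds x {y@(suc _)} _ y≤N =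
  ℕ.n≢0⇒n>0 (gcd[m,n]≢0 x y (inj₂ (λ ()))) , ℕ.≤-trans (gcd[m,n]≤n x y) y≤N

gcd[m,n+m]≡gcd[m,n] : ∀ m n → gcd m (n +ℕ m) ≡ gcd m n
gcd[m,n+m]≡gcd[m,n] m n = GCD.unique (gcd-GCD m (n +ℕ m))
  (subst (λ x → GCD.GCD m x (gcd m n)) (ℕ.+-comm m n) (GCD.step (gcd-GCD m n)))

gcd[m,1+m]≡1 : ∀ m → gcd m (suc m) ≡ 1
gcd[m,1+m]≡1 m = trans (gcd[m,n+m]≡gcd[m,n] m 1) (gcd-zeroʳ m)

gcd[m,2] : ∀ m → gcd m 2 ≡ (if does (2 ∣? m) then 2 else 1)
gcd[m,2] m with 2 ∣? m
... | yes 2∣m = trans (GCD.unique (gcd-GCD m 2) (GCD.is (2∣m , ∣-refl) proj₂)) (sym (if-∣ 2 1 2∣m))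
... | no 2∤m = trans gcd≡1 (sym (if-∤ 2 1 2∤m))
  where
  gcd≡1 : gcd m 2 ≡ 1
  gcd≡1 with prime⇒irreducible prime[2] (gcd[m,n]∣n m 2)
  ... | inj₁ gcd≡1 = gcd≡1
  ... | inj₂ gcd≡2 = ⊥-elim (2∤m (subst (_∣ m) gcd≡2 (gcd[m,n]∣m m 2)))

subsetGcds : ℕ → ℕ → ℕ → List ℕ
subsetGcds a b c = a ∷ b ∷ c ∷ gcd a b ∷ gcd b c ∷ gcd a c ∷ gcd (gcd a b) c ∷ []

subsetGcds-consecutive : ∀ a →
  subsetGcds a (1 +ℕ a) (2 +ℕ a) ≡ a ∷ 1 +ℕ a ∷ 2 +ℕ a ∷ 1 ∷ 1 ∷ gcd a 2 ∷ 1 ∷ []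
subsetGcds-consecutive a = cong (λ gs → a ∷ 1 +ℕ a ∷ 2 +ℕ a ∷ gs)
  (cong₂ _∷_ (gcd[m,1+m]≡1 a) (cong₂ _∷_ (gcd[m,1+m]≡1 (1 +ℕ a))
  (cong₂ _∷_ (gcd[m,n+m]≡gcd[m,n] a 2)
  (cong₂ _∷_ (trans (cong (λ g → gcd g (2 +ℕ a)) (gcd[m,1+m]≡1 a)) (gcd-zeroˡ (2 +ℕ a))) refl))))

2^[∣]-expansion : ∀ d a b c →
  + (2 ^ ([ d ∣ a ] +ℕ [ d ∣ b ] +ℕ [ d ∣ c ])) ≡ 1ℤ + sumℤ (map (λ m → + [ d ∣ m ]) (subsetGcds a b c))
2^[∣]-expansion d a b c = begin
  + (2 ^ (x +ℕ y +ℕ z))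
    ≡⟨ cong +_ (trans (ℕ.^-distribˡ-+-* 2 (x +ℕ y) z) (cong (_*ℕ 2 ^ z) (ℕ.^-distribˡ-+-* 2 x y))) ⟩
  + (2 ^ x *ℕ 2 ^ y *ℕ 2 ^ z)
    ≡⟨ trans (ℤ.pos-* (2 ^ x *ℕ 2 ^ y) (2 ^ z)) (cong (_* + 2 ^ z) (ℤ.pos-* (2 ^ x) (2 ^ y))) ⟩
  + 2 ^ x * + 2 ^ y * + 2 ^ z
    ≡⟨ cong₂ _*_ (cong₂ _*_ (2^[∣] d a) (2^[∣] d b)) (2^[∣] d c) ⟩
  (1ℤ + A) * (1ℤ + B) * (1ℤ + C)
    ≡⟨ expand A B C ⟩
  1ℤ + (A + (B + (C + (A * B + (B * C + (A * C + (A * B * C + 0ℤ)))))))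
    ≡⟨ cong (λ t → 1ℤ + (A + (B + (C + t)))) (cong₂ _+_ AB (cong₂ _+_ BC (cong₂ _+_ AC (cong (_+ 0ℤ) ABC)))) ⟩
  1ℤ + sumℤ (map (λ m → + [ d ∣ m ]) (subsetGcds a b c))
    ∎
  where
  open ≡-Reasoning
  x = [ d ∣ a ]
  y = [ d ∣ b ]
  z = [ d ∣ c ]
  A B C : ℤ
  A = + x
  B = + y
  C = + z
  AB = [∣]-*-gcd d a b
  BC = [∣]-*-gcd d b c
  AC = [∣]-*-gcd d a c
  ABC = trans (cong (_* C) AB) ([∣]-*-gcd d (gcd a b) c)
  expand : ∀ (a b c : ℤ) → (1ℤ + a) * (1ℤ + b) * (1ℤ + c) ≡
    1ℤ + (a + (b + (c + (a * b + (b * c + (a * c + (a * b * c + 0ℤ)))))))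
  expand = solve-∀

sum-μ-2^[∣] : ∀ {N} a b c → 1 ≤ a → 1 ≤ b → 1 ≤ c → a ≤ N → b ≤ N → c ≤ N →
  sum1to N (λ d → μ d * + (2 ^ ([ d ∣ a ] +ℕ [ d ∣ b ] +ℕ [ d ∣ c ])))
    ≡ M N + sumℤ (map (λ g → + [ g ∣ 1 ]) (subsetGcds a b c))
sum-μ-2^[∣] {N} a b c 1≤a 1≤b 1≤c a≤N b≤N c≤N = begin
  sum1to N (λ d → μ d * + (2 ^ ([ d ∣ a ] +ℕ [ d ∣ b ] +ℕ [ d ∣ c ])))
    ≡⟨ sum1to-cong N expand ⟩
  sum1to N (λ d → μ d + μ d * Σ d)
    ≡⟨ sum1to-+ N μ (λ d → μ d * Σ d) ⟩
  M N + sum1to N (λ d → μ d * Σ d)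
    ≡⟨ cong (λ x → M N + x) (möbius-sums (subsetGcds a b c) bounds) ⟩
  M N + sumℤ (map (λ g → + [ g ∣ 1 ]) (subsetGcds a b c)) ∎
  where
  open ≡-Reasoning
  Σ : ℕ → ℤ
  Σ d = sumℤ (map (λ m → + [ d ∣ m ]) (subsetGcds a b c))
  expand : ∀ d → let D = suc d in
    μ D * + (2 ^ ([ D ∣ a ] +ℕ [ D ∣ b ] +ℕ [ D ∣ c ])) ≡ μ D + μ D * Σ D
  expand d = begin
    μ D * + (2 ^ ([ D ∣ a ] +ℕ [ D ∣ b ] +ℕ [ D ∣ c ]))  ≡⟨ cong (μ D *_) (2^[∣]-expansion D a b c) ⟩
    μ D * (1ℤ + Σ D)                                     ≡⟨ ℤ.*-distribˡ-+ (μ D) 1ℤ (Σ D) ⟩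
    μ D * 1ℤ + μ D * Σ D                                 ≡⟨ cong (_+ μ D * Σ D) (ℤ.*-identityʳ (μ D)) ⟩
    μ D + μ D * Σ D                                      ∎
    where D = suc d
  bounds : All (λ m → 1 ≤ m × m ≤ N) (subsetGcds a b c)
  bounds = (1≤a , a≤N) ∷ (1≤b , b≤N) ∷ (1≤c , c≤N) ∷ gcd-bounds a 1≤b b≤N ∷ gcd-bounds b 1≤c c≤N
         ∷ gcd-bounds a 1≤c c≤N ∷ gcd-bounds (gcd a b) 1≤c c≤N ∷ []

theorem5 : (n : ℕ) → 3 < n →
    sum1to n (λ d → μ d * + (2 ^ (fl n d ∸ fl (n ∸ 3) d)))
      ≡ (if even? n then + 3 + M n else + 4 + M n)
theorem5 1 (s≤s ())
theorem5 2 (s≤s (s≤s ()))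
theorem5 3 (s≤s (s≤s (s≤s ())))
theorem5 n@(suc (suc (suc k@(suc _)))) _ = begin
  sum1to n (λ d → μ d * + (2 ^ (fl n d ∸ fl k d)))
    ≡⟨ sum1to-cong n (λ d → cong (λ e → μ (suc d) * + (2 ^ e)) ([3+k]/d∸k/d k (suc d))) ⟩
  sum1to n (λ d → μ d * + (2 ^ ([ d ∣ a ] +ℕ [ d ∣ 1 +ℕ a ] +ℕ [ d ∣ 2 +ℕ a ])))
    ≡⟨ sum-μ-2^[∣] a (1 +ℕ a) n (s≤s z≤n) (s≤s z≤n) (s≤s z≤n) (ℕ.m≤n+m a 2) (ℕ.n≤1+n (1 +ℕ a)) ℕ.≤-refl ⟩
  M n + sumℤ (map [_∣1] (subsetGcds a (1 +ℕ a) (2 +ℕ a)))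
    ≡⟨ cong (λ gs → M n + sumℤ (map [_∣1] gs)) (subsetGcds-consecutive a) ⟩
  M n + sumℤ (map [_∣1] (a ∷ 1 +ℕ a ∷ 2 +ℕ a ∷ 1 ∷ 1 ∷ gcd a 2 ∷ 1 ∷ []))
    ≡⟨ cong (λ g → M n + sumℤ (map [_∣1] (a ∷ 1 +ℕ a ∷ 2 +ℕ a ∷ 1 ∷ 1 ∷ g ∷ 1 ∷ []))) (gcd[m,2] a) ⟩
  M n + sumℤ (map [_∣1] (a ∷ 1 +ℕ a ∷ 2 +ℕ a ∷ 1 ∷ 1 ∷ (if does (2 ∣? a) then 2 else 1) ∷ 1 ∷ []))
    ≡⟨ count (does (2 ∣? a)) ⟩
  (if does (2 ∣? a) then + 3 + M n else + 4 + M n)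
    ≡⟨ cong (if_then + 3 + M n else + 4 + M n) even?n≡2∣?a ⟨
  (if even? n then + 3 + M n else + 4 + M n) ∎
  where
  open ≡-Reasoning
  a = suc k
  [_∣1] : ℕ → ℤ
  [ g ∣1] = + [ g ∣ 1 ]
  -- a, 1 + a and 2 + a are at least 2, so their indicators evaluate to 0.
  count : ∀ parity →
    M n + sumℤ (map [_∣1] (a ∷ 1 +ℕ a ∷ 2 +ℕ a ∷ 1 ∷ 1 ∷ (if parity then 2 else 1) ∷ 1 ∷ []))
      ≡ (if parity then + 3 + M n else + 4 + M n)
  count true  = ℤ.+-comm (M n) (+ 3)
  count false = ℤ.+-comm (M n) (+ 4)
  -- even? (2 + a) evaluates to even? a, since (2 + a) % 2 computes to a % 2.
  even?n≡2∣?a : even? n ≡ does (2 ∣? a)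
  even?n≡2∣?a = isDiv≡does∣? 1 a
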